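{- Let $\mathfrak{Q} := (\mathbb{Q}, <, =, >)$ be the concrete domain of the rational numbers with the standard binary order and equality relations, let $\mathsf{child} \in \mathsf{N_R}$ and $\mathsf{salary} \in \mathsf{N_F}$, and let $$C_{\mathsf{ex}} := \mathsf{succ}\big(|\mathsf{child} \cap (\mathsf{salary} < \partial\,\mathsf{salary})| > |\mathsf{child} \cap (\mathsf{salary} < \partial\,\mathsf{salary})^c|\big).$$ Then there is no $\mathcal{ALCOSCC}(\mathfrak{Q})$ concept that contains no feature roles and is equivalent to $C_{\mathsf{ex}}$, i.e. has the same extension as $C_{\mathsf{ex}}$ in every finitely branching interpretation.
   Context: Fix pairwise disjoint, at most countable sets $\mathsf{N_C}, \mathsf{N_R}, \mathsf{N_I}, \mathsf{N_F}$ of concept, role, individual and feature names. A concrete domain is a relational structure $\mathfrak{D} = (D, P_1^D, P_2^D, \dots)$ over a non-empty countable relational signature, each $k$-ary predicate $P$ interpreted as $P^D \subseteq D^k$. A feature path is $f$ or $r f$ ($r \in \mathsf{N_R}$, $f\in\mathsf{N_F}$). A feature pointer is $f$ or $\partial f$; a feature role is $P(\alpha_1,\dots,\alpha_k)$ with feature pointers $\alpha_i$ and $P$ a $k$-ary predicate of $\mathfrak{D}$ (e.g. $(\mathsf{salary} < \partial\,\mathsf{salary})$ is ${<}(\mathsf{salary},\partial\,\mathsf{salary})$). QFBAPA: set terms are built from set variables and $\emptyset, \mathcal{U}$ by $\cap, \cup$ and complement ${}^c$; set constraints are $s \subseteq t$, $s = t$; PA expressions are $n_0 + n_1 |s_1|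 + \dots + n_k |s_k|$ with $n_i \in \mathbb{N}$ and $s_i$ set terms; numerical constraints are $\ell = \ell'$, $\ell < \ell'$ (also written $\ell'>\ell$), $n \mathrel{\mathsf{div}} \ell$. $\mathcal{ALCOSCC}(\mathfrak{D})$ concepts are: concept names $A$, nominals $\{a\}$ ($a\in\mathsf{N_I}$), $\neg C$, $C \sqcap D$, concrete domain restrictions $\exists p_1,\dots,p_k.P$ ($p_i$ feature paths, $P$ a $k$-ary predicate of $\mathfrak{D}$), and successor restrictions $\mathsf{succ}(\mathfrak{con})$ where $\mathfrak{con}$ is a set constraint or numerical constraint whose set variables are role names, concepts and feature roles. An interpretation $\mathcal{I}$ has a non-empty domain $\Delta^\mathcal{I}$, $A^\mathcal{I} \subseteq \Delta^\mathcal{I}$, $r^\mathcal{I} \subseteq \Delta^\mathcal{I}\times\Delta^\mathcal{I}$, $a^\mathcal{I}\in\Delta^\mathcal{I}$ and partial functions $f^\mathcal{I}: \Delta^\mathcal{I} \rightharpoonup D$; it must be finitely branching, i.e. $\mathsf{ars}^\mathcal{I}(d) := \bigcup_{r\in\mathsf{N_R}} r^\mathcal{I}(d)$ is finite for every $d$, where $r^\mathcal{I}(d) = \{e \mid (d,e)\in r^\mathcal{I}\}$. Semantics: $\neg,\sqcap$ as complement/intersection, $\{a\}^\mathcal{I} = \{a^\mathcal{I}\}$; $p^\mathcal{I}(d) = \{f^\mathcal{I}(d)\}$ if $p=f$ (empty if undefined) and $p^\mathcal{I}(d) = \{f^\mathcal{I}(e) \mid e \in r^\mathcal{I}(d)\}$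 (defined values) if $p = rf$; $d \in (\exists p_1,\dots,p_k.P)^\mathcal{I}$ iff some tuple in $p_1^\mathcal{I}(d)\times\dots\times p_k^\mathcal{I}(d)$ is in $P^D$. For $\gamma = P(\alpha_1,\dots,\alpha_k)$, $(d,e)\in\gamma^\mathcal{I}$ iff $(c_1,\dots,c_k)\in P^D$ where $c_i = f_i^\mathcal{I}(d)$ if $\alpha_i = f_i$ and $c_i = f_i^\mathcal{I}(e)$ if $\alpha_i = \partial f_i$ (all defined). Each $d$ induces the QFBAPA assignment $\sigma_d$ with $\sigma_d(\mathcal{U}) = \mathsf{ars}^\mathcal{I}(d)$, $\sigma_d(r) = r^\mathcal{I}(d)$, $\sigma_d(C) = C^\mathcal{I}\cap\mathsf{ars}^\mathcal{I}(d)$, $\sigma_d(\gamma) = \gamma^\mathcal{I}(d)\cap \mathsf{ars}^\mathcal{I}(d)$ (with $|\cdot|$ cardinality, other operations standard); $d \in \mathsf{succ}(\mathfrak{con})^\mathcal{I}$ iff $\sigma_d$ satisfies $\mathfrak{con}$. -}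

module Defs where

open import Data.Nat using (ℕ; zero; suc; _+_; _*_)
import Data.Nat as ℕ
open import Data.Nat.Divisibility using (_∣?_)
open import Data.Bool using (Bool; true; false; _∧_; _∨_; not; if_then_else_)
open import Data.List using (List; []; _∷_; length; filter; map; concatMap)
open import Data.Bool.ListAction using (any; all)
open import Data.List.Relation.Unary.Unique.Propositional using (Unique)
open import Data.List.Membership.Propositional using (_∈_)
open import Data.Maybe using (Maybe; just; nothing)
open import Data.Product using (∃)
open import Data.Empty using (⊥)
open import Data.Unit using (⊤)
open import Data.Product using (_×_)
open import Data.Rational using (ℚ)
import Data.Rational as ℚ
import Data.Rational.Properties as ℚP
open import Relation.Nullary using (does)
open import Relation.Binary.PropositionalEquality using (_≡_)
open import Relation.Binary.Definitions using (DecidableEquality)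

ConceptName RoleName IndName FeatureName : Set
ConceptName = ℕ
RoleName    = ℕ
IndName     = ℕ
FeatureName = ℕ

data QPred : Set where
  lt eq gt : QPred

⟦_⟧P : QPred → ℚ → ℚ → Bool
⟦ lt ⟧P x y = does (x ℚP.<? y)
⟦ eq ⟧P x y = does (x ℚP.≟ y)
⟦ gt ⟧P x y = does (y ℚP.<? x)

data FeaturePath : Set where
  feat : FeatureName → FeaturePath
  _·_  : RoleName → FeatureName → FeaturePath

data FeaturePointer : Set where
  here : FeatureName → FeaturePointer
  ∂    : FeatureName → FeaturePointer

record FeatureRole : Set where
  constructor fr
  field
    pred : QPred
    arg₁ arg₂ : FeaturePointer

mutual
  data Concept : Set where
    atom  : ConceptName → Concept
    nom   : IndName → Concept
    ¬c_   : Concept → Concept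
    _⊓_   : Concept → Concept → Concept
    cdr   : FeaturePath → FeaturePath → QPred → Concept
    succ  : Constraint → Concept

  data SetVar : Set where
    vrole : RoleName → SetVar
    vconc : Concept → SetVar
    vfr   : FeatureRole → SetVar

  data SetTerm : Set where
    var    : SetVar → SetTerm
    ∅ 𝓤    : SetTerm
    _∩_ _∪_ : SetTerm → SetTerm → SetTerm
    _ᶜ     : SetTerm → SetTerm

  data PAExpr : Set where
    const : ℕ → PAExpr
    _+[_×∣_∣] : PAExpr → ℕ → SetTerm → PAExpr

  data Constraint : Set where
    _⊆_ _≐_   : SetTerm → SetTerm → Constraint
    _=ℓ_ _<ℓ_ : PAExpr → PAExpr → Constraint
    _dvd_     : ℕ → PAExpr → Constraint

mutual
  NoFRC : Concept → Set
  NoFRC (atom _)     = ⊤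
  NoFRC (nom _)      = ⊤
  NoFRC (¬c C)       = NoFRC C
  NoFRC (C ⊓ D)      = NoFRC C × NoFRC D
  NoFRC (cdr _ _ _)  = ⊤
  NoFRC (succ c)     = NoFRK c

  NoFRV : SetVar → Set
  NoFRV (vrole _) = ⊤
  NoFRV (vconc C) = NoFRC C
  NoFRV (vfr _)   = ⊥

  NoFRS : SetTerm → Set
  NoFRS (var v)  = NoFRV v
  NoFRS ∅        = ⊤
  NoFRS 𝓤        = ⊤
  NoFRS (s ∩ t)  = NoFRS s × NoFRS t
  NoFRS (s ∪ t)  = NoFRS s × NoFRS t
  NoFRS (s ᶜ)    = NoFRS s

  NoFRE : PAExpr → Set
  NoFRE (const _)       = ⊤
  NoFRE (ℓ +[ _ ×∣ s ∣]) = NoFRE ℓ × NoFRS s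

  NoFRK : Constraint → Set
  NoFRK (s ⊆ t)   = NoFRS s × NoFRS t
  NoFRK (s ≐ t)   = NoFRS s × NoFRS t
  NoFRK (ℓ =ℓ ℓ') = NoFRE ℓ × NoFRE ℓ'
  NoFRK (ℓ <ℓ ℓ') = NoFRE ℓ × NoFRE ℓ'
  NoFRK (_ dvd ℓ) = NoFRE ℓ

-- Membership in concept/role names is Bool-valued (decidable), the domain has
-- decidable equality, and finite branching is witnessed by a duplicate-free
-- list  ars d  which is exactly  ⋃_r r^I(d).

record Interp : Set₁ where
  field
    Δ        : Set
    _≟Δ_     : DecidableEquality Δ
    inhabit  : Δ
    conc     : ConceptName → Δ → Bool
    role     : RoleName → Δ → Δ → Bool
    ind      : IndName → Δ
    featV    : FeatureName → Δ → Maybe ℚ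
    ars      : Δ → List Δ
    ars-unique   : ∀ d → Unique (ars d)
    ars-sound    : ∀ r d e → role r d e ≡ true → e ∈ ars d
    ars-complete : ∀ d e → e ∈ ars d → ∃ λ r → role r d e ≡ true

module Sem (I : Interp) where
  open Interp I

  maybeL : Maybe ℚ → List ℚ
  maybeL (just x) = x ∷ []
  maybeL nothing  = []

  pathVals : FeaturePath → Δ → List ℚ
  pathVals (feat f) d  = maybeL (featV f d)
  pathVals (r · f) d   = concatMap (λ e → maybeL (featV f e)) (filter (λ e → role r d e ≡? true) (ars d))
    where
      open import Data.Bool.Properties using () renaming (_≟_ to _≡?_)

  ptr : FeaturePointer → Δ → Δ → Maybe ℚ
  ptr (here f) d e = featV f d
  ptr (∂ f)    d e = featV f e

  frSem : FeatureRole → Δ → Δ → Bool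
  frSem (fr P α β) d e with ptr α d e | ptr β d e
  ... | just x | just y = ⟦ P ⟧P x y
  ... | _      | _      = false

  card : Δ → (Δ → Bool) → ℕ
  card d p = length (filter (λ e → p e Data.Bool.Properties.≟ true) (ars d))
    where import Data.Bool.Properties

  mutual
    ⟦_⟧ : Concept → Δ → Bool
    ⟦ atom A ⟧ d     = conc A d
    ⟦ nom a ⟧ d      = does (d ≟Δ ind a)
    ⟦ ¬c C ⟧ d       = not (⟦ C ⟧ d)
    ⟦ C ⊓ D ⟧ d      = ⟦ C ⟧ d ∧ ⟦ D ⟧ d
    ⟦ cdr p q P ⟧ d  = any (λ x → any (λ y → ⟦ P ⟧P x y) (pathVals q d)) (pathVals p d)
    ⟦ succ c ⟧ d     = ⟦ c ⟧K d

    ⟦_⟧V : SetVar → Δ → Δ → Bool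
    ⟦ vrole r ⟧V d e = role r d e
    ⟦ vconc C ⟧V d e = ⟦ C ⟧ e
    ⟦ vfr γ ⟧V d e   = frSem γ d e

    -- e ∈ σ_d(s), for e ∈ ars(d) = σ_d(𝓤)
    ⟦_⟧S : SetTerm → Δ → Δ → Bool
    ⟦ var v ⟧S d e  = ⟦ v ⟧V d e
    ⟦ ∅ ⟧S d e      = false
    ⟦ 𝓤 ⟧S d e      = true
    ⟦ s ∩ t ⟧S d e  = ⟦ s ⟧S d e ∧ ⟦ t ⟧S d e
    ⟦ s ∪ t ⟧S d e  = ⟦ s ⟧S d e ∨ ⟦ t ⟧S d e
    ⟦ s ᶜ ⟧S d e    = not (⟦ s ⟧S d e)

    ⟦_⟧E : PAExpr → Δ → ℕ
    ⟦ const n ⟧E d        = n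
    ⟦ ℓ +[ n ×∣ s ∣] ⟧E d = ⟦ ℓ ⟧E d + n * card d (⟦ s ⟧S d)

    ⟦_⟧K : Constraint → Δ → Bool
    ⟦ s ⊆ t ⟧K d   = all (λ e → not (⟦ s ⟧S d e) ∨ ⟦ t ⟧S d e) (ars d)
    ⟦ s ≐ t ⟧K d   = all (λ e → (⟦ s ⟧S d e ∧ ⟦ t ⟧S d e) ∨ (not (⟦ s ⟧S d e) ∧ not (⟦ t ⟧S d e))) (ars d)
    ⟦ ℓ =ℓ ℓ' ⟧K d = does (⟦ ℓ ⟧E d ℕ.≟ ⟦ ℓ' ⟧E d)
    ⟦ ℓ <ℓ ℓ' ⟧K d = does (⟦ ℓ ⟧E d ℕ.<? ⟦ ℓ' ⟧E d)
    ⟦ n dvd ℓ ⟧K d = does (n ∣? ⟦ ℓ ⟧E d)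

ext : (I : Interp) → Concept → Interp.Δ I → Bool
ext I C = Sem.⟦_⟧ I C

Equivalent : Concept → Concept → Set₁
Equivalent C D = ∀ (I : Interp) (d : Interp.Δ I) → ext I C d ≡ ext I D d

child : RoleName
child = 0

salary : FeatureName
salary = 0

salLess : FeatureRole
salLess = fr lt (here salary) (∂ salary)

Cex : Concept
Cex = succ ((const 0 +[ 1 ×∣ var (vrole child) ∩ (var (vfr salLess) ᶜ) ∣])
            <ℓ (const 0 +[ 1 ×∣ var (vrole child) ∩ var (vfr salLess) ∣]))

-- A concept without feature roles can look at feature values only through
-- concrete domain restrictions ∃p₁,p₂.P, and these compare values along paths
-- of one node: they only see which values occur, not how often. So take a
-- parent with salary 0 and three children, paid 1, 1, −1 in one interpretation
-- and 1, −1, −1 in the other. C_ex holds at the parent in the first and fails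
-- in the second, yet no concrete domain restriction tells the two apart, hence
-- neither does any concept without feature roles.
module Submission where

open import Defs
open import Data.Bool using (Bool; true; false; _∧_; _∨_; not)
open import Data.Bool.ListAction using (any; all; and; or)
import Data.Bool.Properties as Bool
open import Data.Empty using (⊥-elim)
open import Data.Fin using (Fin; zero; suc)
import Data.Fin as Fin
open import Data.List using (List; []; _∷_; length)
open import Data.List.Properties using (map-cong; filter-≐)
open import Data.List.Membership.Propositional using (_∈_)
open import Data.List.Relation.Unary.All using ([]; _∷_)
open import Data.List.Relation.Unary.AllPairs using ([]; _∷_)
open import Data.List.Relation.Unary.Any using (here; there)
open import Data.List.Relation.Unary.Unique.Propositional using (Unique)
open import Data.Maybe using (Maybe; just; nothing)
import Data.Nat as ℕ
open import Data.Nat.Divisibility using (_∣?_)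
open import Data.Product using (Σ; _×_; _,_; ∃)
open import Data.Rational using (ℚ; 0ℚ; 1ℚ; -_)
open import Function using (_$_)
open import Relation.Binary.PropositionalEquality
  using (_≡_; _≢_; _≗_; refl; sym; trans; cong; cong₂; module ≡-Reasoning)
open import Relation.Nullary using (¬_; does)

record _≈any_ {A : Set} (xs ys : List A) : Set where
  constructor mk≈any
  field any-≡ : ∀ p → any p xs ≡ any p ys
open _≈any_

≈any-refl : {A : Set} {xs : List A} → xs ≈any xs
≈any-refl = mk≈any λ _ → refl

any²-cong : {A B : Set} (R : A → B → Bool) {xs xs′ : List A} {ys ys′ : List B} →
            xs ≈any xs′ → ys ≈any ys′ →
            any (λ x → any (R x) ys) xs ≡ any (λ x → any (R x) ys′) xs′
any²-cong R {xs} xs≈xs′ ys≈ys′ =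
  trans (cong or (map-cong (λ x → any-≡ ys≈ys′ (R x)) xs)) (any-≡ xs≈xs′ _)

aab≈any-abb : {A : Set} (a b : A) → (a ∷ a ∷ b ∷ []) ≈any (a ∷ b ∷ b ∷ [])
aab≈any-abb a b = mk≈any λ p → ∨-dup-swap (p a) (p b)
  where
  ∨-dup-swap : ∀ x y → x ∨ (x ∨ (y ∨ false)) ≡ x ∨ (y ∨ (y ∨ false))
  ∨-dup-swap true  _     = refl
  ∨-dup-swap false true  = refl
  ∨-dup-swap false false = refl

_withFeatures_ : (I : Interp) → (FeatureName → Interp.Δ I → Maybe ℚ) → Interp
I withFeatures φ = record I { featV = φ }

module _ (I : Interp) (φ ψ : FeatureName → Interp.Δ I → Maybe ℚ) where
  open Interp I using (Δ; ars)

  private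
    module Φ = Sem (I withFeatures φ)
    module Ψ = Sem (I withFeatures ψ)

    card-cong : ∀ d {p q : Δ → Bool} → p ≗ q → Φ.card d p ≡ Ψ.card d q
    card-cong d p≗q = cong length (filter-≐ (λ e → _ Bool.≟ true) (λ e → _ Bool.≟ true)
      ((λ {e} pe → trans (sym (p≗q e)) pe) , (λ {e} qe → trans (p≗q e) qe)) (ars d))

    all-cong : ∀ {A : Set} {p q : A → Bool} → p ≗ q → ∀ xs → all p xs ≡ all q xs
    all-cong p≗q xs = cong and (map-cong p≗q xs)

  module _ (cdr-agrees : ∀ p q P d → Φ.⟦ cdr p q P ⟧ d ≡ Ψ.⟦ cdr p q P ⟧ d) where
    mutual
      ⟦⟧-featureBlind : ∀ C → NoFRC C → Φ.⟦ C ⟧ ≗ Ψ.⟦ C ⟧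
      ⟦⟧-featureBlind (atom _)    _       d = refl
      ⟦⟧-featureBlind (nom _)     _       d = refl
      ⟦⟧-featureBlind (¬c C)      C-free  d = cong not (⟦⟧-featureBlind C C-free d)
      ⟦⟧-featureBlind (C ⊓ D)     (C-free , D-free) d =
        cong₂ _∧_ (⟦⟧-featureBlind C C-free d) (⟦⟧-featureBlind D D-free d)
      ⟦⟧-featureBlind (cdr p q P) _       d = cdr-agrees p q P d
      ⟦⟧-featureBlind (succ c)    c-free  d = ⟦⟧K-featureBlind c c-free d

      ⟦⟧V-featureBlind : ∀ x → NoFRV x → ∀ d → Φ.⟦ x ⟧V d ≗ Ψ.⟦ x ⟧V d
      ⟦⟧V-featureBlind (vrole _) _      d e = refl
      ⟦⟧V-featureBlind (vconc C) C-free d e = ⟦⟧-featureBlind C C-free e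

      ⟦⟧S-featureBlind : ∀ s → NoFRS s → ∀ d → Φ.⟦ s ⟧S d ≗ Ψ.⟦ s ⟧S d
      ⟦⟧S-featureBlind (var x) x-free d e = ⟦⟧V-featureBlind x x-free d e
      ⟦⟧S-featureBlind ∅       _      d e = refl
      ⟦⟧S-featureBlind 𝓤       _      d e = refl
      ⟦⟧S-featureBlind (s ∩ t) (s-free , t-free) d e =
        cong₂ _∧_ (⟦⟧S-featureBlind s s-free d e) (⟦⟧S-featureBlind t t-free d e)
      ⟦⟧S-featureBlind (s ∪ t) (s-free , t-free) d e =
        cong₂ _∨_ (⟦⟧S-featureBlind s s-free d e) (⟦⟧S-featureBlind t t-free d e)
      ⟦⟧S-featureBlind (s ᶜ)   s-free d e = cong not (⟦⟧S-featureBlind s s-free d e)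

      ⟦⟧E-featureBlind : ∀ ℓ → NoFRE ℓ → Φ.⟦ ℓ ⟧E ≗ Ψ.⟦ ℓ ⟧E
      ⟦⟧E-featureBlind (const _)        _                 d = refl
      ⟦⟧E-featureBlind (ℓ +[ n ×∣ s ∣]) (ℓ-free , s-free) d =
        cong₂ (λ a b → a ℕ.+ n ℕ.* b) (⟦⟧E-featureBlind ℓ ℓ-free d)
              (card-cong d (⟦⟧S-featureBlind s s-free d))

      ⟦⟧K-featureBlind : ∀ c → NoFRK c → Φ.⟦ c ⟧K ≗ Ψ.⟦ c ⟧K
      ⟦⟧K-featureBlind (s ⊆ t) (s-free , t-free) d = all-cong (λ e →
        cong₂ (λ a b → not a ∨ b) (⟦⟧S-featureBlind s s-free d e) (⟦⟧S-featureBlind t t-free d e)) (ars d)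
      ⟦⟧K-featureBlind (s ≐ t) (s-free , t-free) d = all-cong (λ e →
        cong₂ (λ a b → (a ∧ b) ∨ (not a ∧ not b))
              (⟦⟧S-featureBlind s s-free d e) (⟦⟧S-featureBlind t t-free d e)) (ars d)
      ⟦⟧K-featureBlind (ℓ =ℓ ℓ′) (ℓ-free , ℓ′-free) d =
        cong₂ (λ m n → does (m ℕ.≟ n)) (⟦⟧E-featureBlind ℓ ℓ-free d) (⟦⟧E-featureBlind ℓ′ ℓ′-free d)
      ⟦⟧K-featureBlind (ℓ <ℓ ℓ′) (ℓ-free , ℓ′-free) d =
        cong₂ (λ m n → does (m ℕ.<? n)) (⟦⟧E-featureBlind ℓ ℓ-free d) (⟦⟧E-featureBlind ℓ′ ℓ′-free d)
      ⟦⟧K-featureBlind (n dvd ℓ) ℓ-free d =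
        cong (λ m → does (n ∣? m)) (⟦⟧E-featureBlind ℓ ℓ-free d)

Member : Set
Member = Fin 4

pattern parent = zero
pattern kid₁   = suc zero
pattern kid₂   = suc (suc zero)
pattern kid₃   = suc (suc (suc zero))

linked : RoleName → Member → Member → Bool
linked _ parent (suc _) = true
linked _ _      _       = false

kids : Member → List Member
kids parent  = kid₁ ∷ kid₂ ∷ kid₃ ∷ []
kids (suc _) = []

kids-unique : ∀ d → Unique (kids d)
kids-unique parent  = ((λ ()) ∷ (λ ()) ∷ []) ∷ ((λ ()) ∷ []) ∷ [] ∷ []
kids-unique (suc _) = []

linked⇒∈kids : ∀ r d e → linked r d e ≡ true → e ∈ kids d
linked⇒∈kids r parent kid₁ _ = here refl
linked⇒∈kids r parent kid₂ _ = there (here refl)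
linked⇒∈kids r parent kid₃ _ = there (there (here refl))

∈kids⇒linked : ∀ d e → e ∈ kids d → ∃ λ r → linked r d e ≡ true
∈kids⇒linked parent parent (there (there (there ())))
∈kids⇒linked parent kid₁   _ = child , refl
∈kids⇒linked parent kid₂   _ = child , refl
∈kids⇒linked parent kid₃   _ = child , refl

family : Interp
family = record
  { Δ = Member ; _≟Δ_ = Fin._≟_ ; inhabit = parent
  ; conc = λ _ _ → false ; role = linked ; ind = λ _ → parent
  ; featV = λ _ _ → nothing
  ; ars = kids ; ars-unique = kids-unique
  ; ars-sound = linked⇒∈kids ; ars-complete = ∈kids⇒linked
  }

salaries₁ salaries₂ : FeatureName → Member → Maybe ℚ
salaries₁ _ parent = just 0ℚ
salaries₁ _ kid₁   = just 1ℚ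
salaries₁ _ kid₂   = just 1ℚ
salaries₁ _ kid₃   = just (- 1ℚ)
salaries₂ _ parent = just 0ℚ
salaries₂ _ kid₁   = just 1ℚ
salaries₂ _ kid₂   = just (- 1ℚ)
salaries₂ _ kid₃   = just (- 1ℚ)

I₁ I₂ : Interp
I₁ = family withFeatures salaries₁
I₂ = family withFeatures salaries₂

private
  module S₁ = Sem I₁
  module S₂ = Sem I₂

pathVals-≈any : ∀ p d → d ≢ kid₂ → S₁.pathVals p d ≈any S₂.pathVals p d
pathVals-≈any (feat _) parent _ = ≈any-refl
pathVals-≈any (_ · _)  parent _ = aab≈any-abb 1ℚ (- 1ℚ)
pathVals-≈any (feat _) kid₁   _ = ≈any-refl
pathVals-≈any (_ · _)  kid₁   _ = ≈any-refl
pathVals-≈any _        kid₂   kid₂≢kid₂ = ⊥-elim (kid₂≢kid₂ refl)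
pathVals-≈any (feat _) kid₃   _ = ≈any-refl
pathVals-≈any (_ · _)  kid₃   _ = ≈any-refl

-- kid₂ moves to the other side of its parent's salary, but on its own it can
-- only compare its salary with itself.
cdr-agrees : ∀ p q P d → S₁.⟦ cdr p q P ⟧ d ≡ S₂.⟦ cdr p q P ⟧ d
cdr-agrees (feat _) (feat _) lt kid₂ = refl
cdr-agrees (feat _) (feat _) eq kid₂ = refl
cdr-agrees (feat _) (feat _) gt kid₂ = refl
cdr-agrees (feat _) (_ · _)  _  kid₂ = refl
cdr-agrees (_ · _)  _        _  kid₂ = refl
cdr-agrees p q P parent = any²-cong ⟦ P ⟧P (pathVals-≈any p parent λ ()) (pathVals-≈any q parent λ ())
cdr-agrees p q P kid₁   = any²-cong ⟦ P ⟧P (pathVals-≈any p kid₁ λ ())   (pathVals-≈any q kid₁ λ ())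
cdr-agrees p q P kid₃   = any²-cong ⟦ P ⟧P (pathVals-≈any p kid₃ λ ())   (pathVals-≈any q kid₃ λ ())

Cex-holds-in-I₁ : ext I₁ Cex parent ≡ true
Cex-holds-in-I₁ = refl

Cex-fails-in-I₂ : ext I₂ Cex parent ≡ false
Cex-fails-in-I₂ = refl

theorem1 : ¬ (Σ Concept λ C → NoFRC C × Equivalent C Cex)
theorem1 (C , C-free , C≡Cex) = true≢false $ begin
    true              ≡⟨ sym Cex-holds-in-I₁ ⟩
    ext I₁ Cex parent ≡⟨ sym (C≡Cex I₁ parent) ⟩
    ext I₁ C parent   ≡⟨ ⟦⟧-featureBlind family salaries₁ salaries₂ cdr-agrees C C-free parent ⟩
    ext I₂ C parent   ≡⟨ C≡Cex I₂ parent ⟩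
    ext I₂ Cex parent ≡⟨ Cex-fails-in-I₂ ⟩
    false             ∎
  where
  open ≡-Reasoning
  true≢false : true ≢ false
  true≢false ()
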